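{- Let $\mathcal S=(\mathit{Sign},\mathit{Sen},\Omega,T)$ be a $\frac32$-institutional seed with $\mathit{Sen}$ strict, and $\mathcal T\subseteq\mathit{Sign}$ a (1-)subcategory such that: (i) a signature morphism is maximal if and only if it is $\mathit{Sen}$-maximal; (ii) $\mathcal T$ contains all maximal signature morphisms; (iii) if $\varphi\in\mathcal T$ and $\varphi\le\varphi'$ then $\varphi'\in\mathcal T$. Then in $\mathcal I(\mathcal S)$ every lax $\mathcal T$-pushout of a span of signature morphisms has model amalgamation.
   Context: Composition is diagrammatic. A $\frac32$-category is a category with partially ordered hom-sets and monotone composition. $\mathbf{Pfn}$: sets and partial functions ordered by graph inclusion. A $\frac32$-institutional seed $(\mathit{Sign},\mathit{Sen},\Omega,T)$: a $\frac32$-category $\mathit{Sign}$, a lax $\frac32$-functor $\mathit{Sen}:\mathit{Sign}\to\mathbf{Pfn}$ (monotone, $\mathit{Sen}(\varphi);\mathit{Sen}(\varphi')\subseteq\mathit{Sen}(\varphi;\varphi')$, $1\subseteq\mathit{Sen}(1_\Sigma)$; strict when these are equalities), an object $\Omega$, $T:\mathit{Sen}(\Omega)\to\{0,1\}$. In $\mathcal I(\mathcal S)$: $\Sigma$-models are arrows $M:\Sigma\to\Omega$ with $\mathit{Sen}(M)$ total; $\mathit{Mod}(\varphi)M'=\{M\text{ a }\operatorname{dom}\varphi\text{ -model}\mid\varphi;M'\le M\}$; $M\models\rho$ iff $T(\mathit{Sen}(M)\rho)=1$. An arrow $\varphi$ is maximal if no $\varphi'\neq\varphi$ satisfies $\varphi\le\varphi'$;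 $\mathit{Sen}$-maximal if $\mathit{Sen}(\varphi)$ is total. For a span $\varphi_k:\Sigma_0\to\Sigma_k$ ($k=1,2$), a lax cocone is $\theta_k:\Sigma_k\to\Sigma$ ($k=0,1,2$) with $\varphi_k;\theta_k\le\theta_0$; lax $\mathcal T$-cocone: all $\theta_k\in\mathcal T$; lax $\mathcal T$-pushout: a lax $\mathcal T$-cocone $\theta$ such that for each lax $\mathcal T$-cocone $\theta'$ there is a unique $\mu\in\mathcal T$ with $\theta_k;\mu=\theta'_k$, $k=0,1,2$. A model of the span: $\Sigma_k$-models $M_k$ with $M_0\in\mathit{Mod}(\varphi_k)M_k$ ($k=1,2$). The lax cocone has model amalgamation if each model $(M_0,M_1,M_2)$ of the span admits a unique $\Sigma$-model $M$ with $M_k\in\mathit{Mod}(\theta_k)M$ for $k=0,1,2$. -}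

module Defs where

open import Level using (Level; _⊔_; suc)
open import Data.Maybe using (Maybe; just; nothing; _>>=_)
open import Data.Bool using (Bool)
open import Data.Product using (Σ; ∃; _×_; _,_)
open import Relation.Binary.PropositionalEquality using (_≡_)
open import Relation.Unary using (Pred)

-- Partial functions (the category Pfn), ordered by graph inclusion.
-- Composition is diagrammatic.

PFun : ∀ {a b} → Set a → Set b → Set (a ⊔ b)
PFun A B = A → Maybe B

_⊆ₚ_ : ∀ {a b} {A : Set a} {B : Set b} → PFun A B → PFun A B → Set (a ⊔ b)
f ⊆ₚ g = ∀ x y → f x ≡ just y → g x ≡ just y

_≈ₚ_ : ∀ {a b} {A : Set a} {B : Set b} → PFun A B → PFun A B → Set (a ⊔ b)
f ≈ₚ g = (f ⊆ₚ g) × (g ⊆ₚ f)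

_⨾ₚ_ : ∀ {a b c} {A : Set a} {B : Set b} {C : Set c} →
       PFun A B → PFun B C → PFun A C
(f ⨾ₚ g) x = f x >>= g

idₚ : ∀ {a} {A : Set a} → PFun A A
idₚ = just

Total : ∀ {a b} {A : Set a} {B : Set b} → PFun A B → Set (a ⊔ b)
Total {A = A} {B} f = ∀ x → ∃ λ y → f x ≡ just y

record ThreeHalfCat (o h r : Level) : Set (suc (o ⊔ h ⊔ r)) where
  infixr 9 _⨾_
  infix 4 _≤_
  field
    Obj  : Set o
    Hom  : Obj → Obj → Set h
    id   : ∀ {A} → Hom A A
    _⨾_  : ∀ {A B C} → Hom A B → Hom B C → Hom A C
    assoc : ∀ {A B C D} (f : Hom A B) (g : Hom B C) (k : Hom C D) →
            (f ⨾ g) ⨾ k ≡ f ⨾ (g ⨾ k)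
    identityˡ : ∀ {A B} (f : Hom A B) → id ⨾ f ≡ f
    identityʳ : ∀ {A B} (f : Hom A B) → f ⨾ id ≡ f
    _≤_  : ∀ {A B} → Hom A B → Hom A B → Set r
    ≤-refl  : ∀ {A B} {f : Hom A B} → f ≤ f
    ≤-trans : ∀ {A B} {f g k : Hom A B} → f ≤ g → g ≤ k → f ≤ k
    ≤-antisym : ∀ {A B} {f g : Hom A B} → f ≤ g → g ≤ f → f ≡ g
    ⨾-mono : ∀ {A B C} {f f' : Hom A B} {g g' : Hom B C} →
             f ≤ f' → g ≤ g' → f ⨾ g ≤ f' ⨾ g'

-- 3/2-institutional seeds (Sen a lax 3/2-functor into Pfn).

record Seed (o h r s : Level) : Set (suc (o ⊔ h ⊔ r ⊔ s)) where
  field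
    Sign : ThreeHalfCat o h r
  open ThreeHalfCat Sign public
  field
    Sen   : Obj → Set s
    Sen₁  : ∀ {A B} → Hom A B → PFun (Sen A) (Sen B)
    Sen-mono : ∀ {A B} {f g : Hom A B} → f ≤ g → Sen₁ f ⊆ₚ Sen₁ g
    Sen-lax-⨾ : ∀ {A B C} (f : Hom A B) (g : Hom B C) →
                (Sen₁ f ⨾ₚ Sen₁ g) ⊆ₚ Sen₁ (f ⨾ g)
    Sen-lax-id : ∀ {A} → idₚ ⊆ₚ Sen₁ (id {A})
    Ω : Obj
    T : Sen Ω → Bool

-- Sen is strict: the lax inequalities are equalities.
record IsStrict {o h r s} (S : Seed o h r s) : Set (o ⊔ h ⊔ s) where
  open Seed S
  field
    Sen-⨾  : ∀ {A B C} (f : Hom A B) (g : Hom B C) →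
             Sen₁ (f ⨾ g) ⊆ₚ (Sen₁ f ⨾ₚ Sen₁ g)
    Sen-id : ∀ {A} → Sen₁ (id {A}) ⊆ₚ idₚ

module _ {o h r s} (S : Seed o h r s) where
  open Seed S

  Maximal : ∀ {A B} → Hom A B → Set (h ⊔ r)
  Maximal {A} {B} f = ∀ (f' : Hom A B) → f ≤ f' → f' ≡ f

  SenMaximal : ∀ {A B} → Hom A B → Set s
  SenMaximal f = Total (Sen₁ f)

  record Subcat (t : Level) : Set (o ⊔ h ⊔ suc t) where
    field
      TObj : Obj → Set t
      TMor : ∀ {A B} → Hom A B → Set t
      dom∈ : ∀ {A B} {f : Hom A B} → TMor f → TObj A
      cod∈ : ∀ {A B} {f : Hom A B} → TMor f → TObj B
      id∈  : ∀ {A} → TObj A → TMor (id {A})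
      ⨾∈   : ∀ {A B C} {f : Hom A B} {g : Hom B C} →
             TMor f → TMor g → TMor (f ⨾ g)

  IsModel : ∀ {A} → Hom A Ω → Set s
  IsModel M = Total (Sen₁ M)

  _∈Mod_⟨_⟩ : ∀ {A B} → Hom A Ω → Hom A B → Hom B Ω → Set (r ⊔ s)
  M ∈Mod φ ⟨ M' ⟩ = IsModel M × (φ ⨾ M' ≤ M)

  record Span : Set (o ⊔ h) where
    field
      Σ₀ Σ₁ Σ₂ : Obj
      φ₁ : Hom Σ₀ Σ₁
      φ₂ : Hom Σ₀ Σ₂

  record LaxCocone (sp : Span) : Set (o ⊔ h ⊔ r) where
    open Span sp
    field
      apex : Obj
      θ₀ : Hom Σ₀ apex
      θ₁ : Hom Σ₁ apex
      θ₂ : Hom Σ₂ apex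
      lax₁ : φ₁ ⨾ θ₁ ≤ θ₀
      lax₂ : φ₂ ⨾ θ₂ ≤ θ₀

  module _ {t} (𝒯 : Subcat t) where
    open Subcat 𝒯

    IsLax𝒯Cocone : {sp : Span} → LaxCocone sp → Set t
    IsLax𝒯Cocone c = TMor θ₀ × TMor θ₁ × TMor θ₂
      where open LaxCocone c

    IsLax𝒯Pushout : {sp : Span} → LaxCocone sp → Set (o ⊔ h ⊔ r ⊔ t)
    IsLax𝒯Pushout {sp} c =
      IsLax𝒯Cocone c ×
      (∀ (c' : LaxCocone sp) → IsLax𝒯Cocone c' →
        Σ (Hom (LaxCocone.apex c) (LaxCocone.apex c')) λ μ →
          (TMor μ ×
           LaxCocone.θ₀ c ⨾ μ ≡ LaxCocone.θ₀ c' ×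
           LaxCocone.θ₁ c ⨾ μ ≡ LaxCocone.θ₁ c' ×
           LaxCocone.θ₂ c ⨾ μ ≡ LaxCocone.θ₂ c') ×
          (∀ (μ' : Hom (LaxCocone.apex c) (LaxCocone.apex c')) → TMor μ' →
             LaxCocone.θ₀ c ⨾ μ' ≡ LaxCocone.θ₀ c' →
             LaxCocone.θ₁ c ⨾ μ' ≡ LaxCocone.θ₁ c' →
             LaxCocone.θ₂ c ⨾ μ' ≡ LaxCocone.θ₂ c' →
             μ' ≡ μ))

  HasModelAmalgamation : {sp : Span} → LaxCocone sp → Set (h ⊔ r ⊔ s)
  HasModelAmalgamation {sp} c =
    ∀ (M₀ : Hom Σ₀ Ω) (M₁ : Hom Σ₁ Ω) (M₂ : Hom Σ₂ Ω) →
      IsModel M₀ → IsModel M₁ → IsModel M₂ →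
      M₀ ∈Mod φ₁ ⟨ M₁ ⟩ → M₀ ∈Mod φ₂ ⟨ M₂ ⟩ →
      Σ (Hom apex Ω) λ M →
        (IsModel M ×
         M₀ ∈Mod θ₀ ⟨ M ⟩ × M₁ ∈Mod θ₁ ⟨ M ⟩ × M₂ ∈Mod θ₂ ⟨ M ⟩) ×
        (∀ (M' : Hom apex Ω) → IsModel M' →
           M₀ ∈Mod θ₀ ⟨ M' ⟩ → M₁ ∈Mod θ₁ ⟨ M' ⟩ → M₂ ∈Mod θ₂ ⟨ M' ⟩ →
           M' ≡ M)
    where open Span sp
          open LaxCocone c

module Submission where

-- Models are exactly the Sen-maximal arrows into Ω, hence (by
-- hypothesis (i)) maximal arrows, hence (by (ii)) arrows of 𝒯.  So a model
-- (M₀, M₁, M₂) of a span is itself a lax 𝒯-cocone with apex Ω, and the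
-- lax 𝒯-pushout θ yields a unique mediating μ ∈ 𝒯 with θₖ ⨾ μ = Mₖ.
--   * μ is maximal: enlarging μ to μ' keeps θₖ ⨾ μ' = Mₖ (the Mₖ are maximal)
--     and keeps μ' in 𝒯 (hypothesis (iii)), so μ' = μ by uniqueness of the
--     mediator; by (i) μ is then a model, and Mₖ ∈ Mod(θₖ) μ trivially.
--   * μ is the only amalgamation: strictness of Sen makes each Sen(θₖ)
--     total, so for any model M' the arrow θₖ ⨾ M' is Sen-maximal; from
--     θₖ ⨾ M' ≤ Mₖ maximality forces θₖ ⨾ M' = Mₖ, and M' = μ by uniqueness.

open import Defs
open import Level using (Level)
open import Function.Bundles using (_⇔_; module Equivalence)
open import Relation.Binary.PropositionalEquality using (_≡_; refl; sym; trans; cong)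
open import Data.Maybe using (Maybe; just; nothing; _>>=_)
open import Data.Product using (Σ; ∃; _×_; _,_; proj₁; proj₂)

>>=-just⇒just : ∀ {a b} {A : Set a} {B : Set b} (m : Maybe A) (g : A → Maybe B) {y : B} →
                (m >>= g) ≡ just y → ∃ λ z → m ≡ just z
>>=-just⇒just (just z) g _ = z , refl
>>=-just⇒just nothing  g ()

module SeedFacts {o h r s} (S : Seed o h r s) where
  open Seed S

  ≡⇒≤ : ∀ {A B} {f g : Hom A B} → f ≡ g → f ≤ g
  ≡⇒≤ refl = ≤-refl

  -- Laxness of Sen: a composite of Sen-maximal arrows is Sen-maximal.
  senMaximal-⨾ : ∀ {A B C} (f : Hom A B) (g : Hom B C) →
                 SenMaximal S f → SenMaximal S g → SenMaximal S (f ⨾ g)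
  senMaximal-⨾ f g total-f total-g x with total-f x
  ... | y , fx≡y with total-g y
  ... | z , gy≡z = z , Sen-lax-⨾ f g x z (trans (cong (_>>= Sen₁ g) fx≡y) gy≡z)

  senMaximal-prefix : IsStrict S → ∀ {A B C} (f : Hom A B) (g : Hom B C) →
                      SenMaximal S (f ⨾ g) → SenMaximal S f
  senMaximal-prefix strict f g total-fg x with total-fg x
  ... | z , fgx≡z = >>=-just⇒just (Sen₁ f x) (Sen₁ g) (IsStrict.Sen-⨾ strict f g x z fgx≡z)

  -- Monotonicity of ⨾: a maximal composite θ ⨾ μ is unchanged when μ grows.
  maximal-⨾-absorbs : ∀ {A B C} (θ : Hom A B) {μ μ' : Hom B C} →
                      Maximal S (θ ⨾ μ) → μ ≤ μ' → θ ⨾ μ' ≡ θ ⨾ μ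
  maximal-⨾-absorbs θ {μ} {μ'} maximal μ≤μ' = maximal (θ ⨾ μ') (⨾-mono ≤-refl μ≤μ')

module LaxPushoutAmalgamation
  {o h r s t} (S : Seed o h r s) (strict : IsStrict S) (𝒯 : Subcat S t)
  (maximal⇔senMaximal : ∀ {A B} (f : Seed.Hom S A B) → Maximal S f ⇔ SenMaximal S f)
  (maximal∈𝒯 : ∀ {A B} (f : Seed.Hom S A B) → Maximal S f → Subcat.TMor 𝒯 f)
  (𝒯-upward : ∀ {A B} (f f' : Seed.Hom S A B) → Subcat.TMor 𝒯 f →
              Seed._≤_ S f f' → Subcat.TMor 𝒯 f')
  where
  open Seed S
  open Subcat 𝒯
  open SeedFacts S

  senMaximal⇒maximal : ∀ {A B} {f : Hom A B} → SenMaximal S f → Maximal S f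
  senMaximal⇒maximal {f = f} = Equivalence.from (maximal⇔senMaximal f)

  model∈𝒯 : ∀ {A} {M : Hom A Ω} → IsModel S M → TMor M
  model∈𝒯 {M = M} m = maximal∈𝒯 M (senMaximal⇒maximal m)

  module Amalgamation
    {sp : Span S} (c : LaxCocone S sp) (pushout : IsLax𝒯Pushout S 𝒯 c)
    {M₀ : Hom (Span.Σ₀ sp) Ω} {M₁ : Hom (Span.Σ₁ sp) Ω} {M₂ : Hom (Span.Σ₂ sp) Ω}
    (m₀ : IsModel S M₀) (m₁ : IsModel S M₁) (m₂ : IsModel S M₂)
    (φ₁M₁≤M₀ : Span.φ₁ sp ⨾ M₁ ≤ M₀) (φ₂M₂≤M₀ : Span.φ₂ sp ⨾ M₂ ≤ M₀)
    where
    open LaxCocone c using (apex; θ₀; θ₁; θ₂)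

    spanModel : LaxCocone S sp
    spanModel = record { apex = Ω ; θ₀ = M₀ ; θ₁ = M₁ ; θ₂ = M₂ ; lax₁ = φ₁M₁≤M₀ ; lax₂ = φ₂M₂≤M₀ }

    mediator : Σ (Hom apex Ω) λ μ →
                 (TMor μ × θ₀ ⨾ μ ≡ M₀ × θ₁ ⨾ μ ≡ M₁ × θ₂ ⨾ μ ≡ M₂) ×
                 (∀ (μ' : Hom apex Ω) → TMor μ' →
                    θ₀ ⨾ μ' ≡ M₀ → θ₁ ⨾ μ' ≡ M₁ → θ₂ ⨾ μ' ≡ M₂ → μ' ≡ μ)
    mediator = proj₂ pushout spanModel (model∈𝒯 m₀ , model∈𝒯 m₁ , model∈𝒯 m₂)

    μ : Hom apex Ω
    μ = proj₁ mediator

    μ∈𝒯 : TMor μ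
    μ∈𝒯 = proj₁ (proj₁ (proj₂ mediator))

    θ₀μ≡M₀ : θ₀ ⨾ μ ≡ M₀
    θ₀μ≡M₀ = proj₁ (proj₂ (proj₁ (proj₂ mediator)))

    θ₁μ≡M₁ : θ₁ ⨾ μ ≡ M₁
    θ₁μ≡M₁ = proj₁ (proj₂ (proj₂ (proj₁ (proj₂ mediator))))

    θ₂μ≡M₂ : θ₂ ⨾ μ ≡ M₂
    θ₂μ≡M₂ = proj₂ (proj₂ (proj₂ (proj₁ (proj₂ mediator))))

    μ-unique : ∀ (μ' : Hom apex Ω) → TMor μ' →
               θ₀ ⨾ μ' ≡ M₀ → θ₁ ⨾ μ' ≡ M₁ → θ₂ ⨾ μ' ≡ M₂ → μ' ≡ μ
    μ-unique = proj₂ (proj₂ mediator)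

    -- Any enlargement of μ is again a 𝒯-mediator, so μ is maximal.
    μ-maximal : Maximal S μ
    μ-maximal μ' μ≤μ' =
      μ-unique μ' (𝒯-upward μ μ' μ∈𝒯 μ≤μ')
        (stillMediates θ₀ m₀ θ₀μ≡M₀) (stillMediates θ₁ m₁ θ₁μ≡M₁) (stillMediates θ₂ m₂ θ₂μ≡M₂)
      where
        stillMediates : ∀ {A} (θ : Hom A apex) {N : Hom A Ω} →
                        IsModel S N → θ ⨾ μ ≡ N → θ ⨾ μ' ≡ N
        stillMediates θ n refl = maximal-⨾-absorbs θ (senMaximal⇒maximal n) μ≤μ'

    μ-model : IsModel S μ
    μ-model = Equivalence.to (maximal⇔senMaximal μ) μ-maximal

    -- Every amalgamation M' of (M₀, M₁, M₂) mediates, hence equals μ.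
    μ-onlyAmalgamation : ∀ (M' : Hom apex Ω) → IsModel S M' →
                         _∈Mod_⟨_⟩ S M₀ θ₀ M' → _∈Mod_⟨_⟩ S M₁ θ₁ M' → _∈Mod_⟨_⟩ S M₂ θ₂ M' →
                         M' ≡ μ
    μ-onlyAmalgamation M' m' (_ , θ₀M'≤M₀) (_ , θ₁M'≤M₁) (_ , θ₂M'≤M₂) =
      μ-unique M' (model∈𝒯 m')
        (mediates θ₀ m₀ θ₀μ≡M₀ θ₀M'≤M₀) (mediates θ₁ m₁ θ₁μ≡M₁ θ₁M'≤M₁)
        (mediates θ₂ m₂ θ₂μ≡M₂ θ₂M'≤M₂)
      where
        -- θ ⨾ M' is Sen-maximal (Sen(θ) is total by strictness), so it is
        -- maximal and cannot lie strictly below the model N.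
        mediates : ∀ {A} (θ : Hom A apex) {N : Hom A Ω} →
                   IsModel S N → θ ⨾ μ ≡ N → θ ⨾ M' ≤ N → θ ⨾ M' ≡ N
        mediates θ n refl θM'≤θμ =
          sym (senMaximal⇒maximal
                 (senMaximal-⨾ θ M' (senMaximal-prefix strict θ μ n) m') (θ ⨾ μ) θM'≤θμ)

mainTheorem3 : ∀ {o h r s t : Level} (S : Seed o h r s) → IsStrict S →
    (𝒯 : Subcat S t) →
    (∀ {A B} (f : Seed.Hom S A B) → Maximal S f ⇔ SenMaximal S f) →
    (∀ {A B} (f : Seed.Hom S A B) → Maximal S f → Subcat.TMor 𝒯 f) →
    (∀ {A B} (f f' : Seed.Hom S A B) → Subcat.TMor 𝒯 f →
    Seed._≤_ S f f' → Subcat.TMor 𝒯 f') →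
    ∀ (sp : Span S) (c : LaxCocone S sp) →
    IsLax𝒯Pushout S 𝒯 c → HasModelAmalgamation S c
mainTheorem3 S strict 𝒯 maximal⇔senMaximal maximal∈𝒯 𝒯-upward sp c pushout
             M₀ M₁ M₂ m₀ m₁ m₂ (_ , φ₁M₁≤M₀) (_ , φ₂M₂≤M₀) =
  μ , (μ-model , (m₀ , ≡⇒≤ θ₀μ≡M₀) , (m₁ , ≡⇒≤ θ₁μ≡M₁) , (m₂ , ≡⇒≤ θ₂μ≡M₂)) ,
  μ-onlyAmalgamation
  where
    open SeedFacts S using (≡⇒≤)
    open LaxPushoutAmalgamation S strict 𝒯 maximal⇔senMaximal maximal∈𝒯 𝒯-upward
    open Amalgamation c pushout m₀ m₁ m₂ φ₁M₁≤M₀ φ₂M₂≤M₀
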